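{- In the setting below, if $\gamma$ is a proper generalizer, then $\mathrm{GCG}_{\simeq}(\Phi,\psi,\overset{\simeq}{\gamma})$ is sound, terminating, and complete up to isomorphisms; that is: every execution terminates; every output $\sigma$ satisfies $\sigma\models\Phi$ and $M_\sigma\models\psi$; and for every assignment $\rho$ with $\rho\models\Phi$ and $M_\rho\models\psi$, every execution outputs some $\sigma$ with $\sigma\simeq\rho$.
   Context: LTS setting. A labeled transition system (LTS) is $\langle\Sigma,Q,Q_0,\Delta\rangle$ (finite labels $\Sigma$, finite states $Q$, initial states $Q_0\subseteq Q$, $\Delta\subseteq Q\times\Sigma\times Q$). Fix an LTS $M_0=\langle\Sigma,Q,Q_0,\Delta_0\rangle$; a completion of $M_0$ is an LTS with the same $\Sigma,Q,Q_0$ and transition relation $\Delta\supseteq\Delta_0$. Let $V=\{x_{p,a,q}: p,q\in Q, a\in\Sigma\}$; an assignment $\sigma:V\to\{0,1\}$ encodes the LTS $M_\sigma$ with $\Sigma,Q,Q_0$ and $\Delta_\sigma=\{(p,a,q):\sigma(x_{p,a,q})=1\}$. $\Phi$ is a propositional formula over $V$ that implies $\bigwedge_{(p,a,q)\in\Delta_0}x_{p,a,q}$. Let $A$ be the set of non-initial states of $M_0$ with no incoming or outgoing transitions in $\Delta_0$. For assignments $\sigma,\rho$ satisfying $\Phi$, $\sigma\simeq\rho$ means there is a bijection $f:Q\to Q$ with $f(q)=q$ for $q\notin A$ such that $(p,a,q)\in\Delta_\sigma$ iff $(f(p),a,f(q))\in\Delta_\rho$. For $\rho\models\Phi$, $[\rho]=\{\sigma:\sigma\models\Phi,\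 \sigma\simeq\rho\}$, also viewed as the formula satisfied exactly by its elements. $\psi$ is a specification with satisfaction relation $M\models\psi$, assumed invariant under isomorphism: if $\sigma\simeq\rho$ then $M_\sigma\models\psi$ iff $M_\rho\models\psi$. A generalizer maps assignments to formulas over $V$; $\gamma$ is proper if for every $\sigma\models\Phi$ with $M_\sigma\not\models\psi$: $\sigma\models\gamma(\sigma)$, and no $\rho$ with $\rho\models\Phi$, $M_\rho\models\psi$ satisfies $\gamma(\sigma)$. The equivalence closure of $\gamma$ is the generalizer $\overset{\simeq}{\gamma}(\rho):=\bigvee_{\sigma\in[\rho]}\gamma(\sigma)$. Algorithm $\mathrm{GCG}_{\simeq}(\Phi,\psi,g)$ for a generalizer $g$: keep $\Phi_{cur}:=\Phi$; while $\Phi_{cur}$ is satisfiable, pick an arbitrary $\sigma\models\Phi_{cur}$; if $M_\sigma\models\psi$, output $\sigma$ and set $\Phi_{cur}:=\Phi_{cur}\wedge\neg[\sigma]$; else set $\Phi_{cur}:=\Phi_{cur}\wedge\neg g(\sigma)$. -}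

module Defs where

open import Data.Nat using (ℕ)
open import Data.Fin using (Fin)
open import Data.Bool using (Bool; true; false)
open import Data.Product using (Σ; ∃; _×_; _,_)
open import Data.List using (List; []; _∷_)
open import Data.List.Relation.Unary.All using (All)
open import Data.List.Membership.Propositional using (_∈_)
open import Relation.Nullary using (¬_)
open import Relation.Binary.PropositionalEquality using (_≡_)
open import Relation.Binary.Construct.Closure.ReflexiveTransitive using (Star)
open import Induction.WellFounded using (Acc)
open import Function.Bundles using (_↔_; Inverse; _⇔_)

record LTS (n k : ℕ) : Set where
  field
    init  : Fin n → Bool
    trans : Fin n → Fin k → Fin n → Bool

-- Assignments σ : V → {0,1}, with V = { x_{p,a,q} }.
Assignment : ℕ → ℕ → Set
Assignment n k = Fin n → Fin k → Fin n → Bool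

-- Propositional formulas over V, identified with their truth functions.
Formula : ℕ → ℕ → Set
Formula n k = Assignment n k → Bool

_⊨_ : ∀ {n k} → Assignment n k → Formula n k → Set
σ ⊨ φ = φ σ ≡ true

Spec : ℕ → ℕ → Set₁
Spec n k = LTS n k → Set

M : ∀ {n k} → (Fin n → Bool) → Assignment n k → LTS n k
M Q0 σ = record { init = Q0 ; trans = σ }

ImpliesΔ0 : ∀ {n k} → Assignment n k → Formula n k → Set
ImpliesΔ0 Δ0 Φ = ∀ σ → σ ⊨ Φ → ∀ p a q → Δ0 p a q ≡ true → σ p a q ≡ true

InA : ∀ {n k} → (Fin n → Bool) → Assignment n k → Fin n → Set
InA Q0 Δ0 q = (Q0 q ≡ false) × (∀ a r → Δ0 q a r ≡ false) × (∀ p a → Δ0 p a q ≡ false)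

Iso : ∀ {n k} → (Fin n → Bool) → Assignment n k → Assignment n k → Assignment n k → Set
Iso {n} Q0 Δ0 σ ρ =
  Σ (Fin n ↔ Fin n) λ f →
    (∀ q → ¬ InA Q0 Δ0 q → Inverse.to f q ≡ q) ×
    (∀ p a q → (σ p a q ≡ true) ⇔ (ρ (Inverse.to f p) a (Inverse.to f q) ≡ true))

Class : ∀ {n k} → (Fin n → Bool) → Assignment n k → Formula n k → Assignment n k → Assignment n k → Set
Class Q0 Δ0 Φ ρ σ = σ ⊨ Φ × Iso Q0 Δ0 σ ρ

Proper : ∀ {n k} → (Fin n → Bool) → Formula n k → Spec n k → (Assignment n k → Formula n k) → Set
Proper Q0 Φ ψ γ =
  ∀ σ → σ ⊨ Φ → ¬ ψ (M Q0 σ) →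
    (σ ⊨ γ σ) × (∀ ρ → ρ ⊨ Φ → ψ (M Q0 ρ) → ¬ (ρ ⊨ γ σ))

-- Generalizers with predicate-valued results (used by the algorithm, so that the
-- possibly infinitary-looking disjunction of the equivalence closure is semantic).
Gen : ℕ → ℕ → Set₁
Gen n k = Assignment n k → Assignment n k → Set

EqClosure : ∀ {n k} → (Fin n → Bool) → Assignment n k → Formula n k → (Assignment n k → Formula n k) → Gen n k
EqClosure Q0 Δ0 Φ γ ρ τ = ∃ λ σ → Class Q0 Δ0 Φ ρ σ × (τ ⊨ γ σ)

-- Algorithm state: Φ_cur = Φ ∧ ⋀ ¬(block), recorded as a list of blocks.
data Block (n k : ℕ) : Set where
  out : Assignment n k → Block n k
  gen : Assignment n k → Block n k

module GCG {n k : ℕ} (Q0 : Fin n → Bool) (Δ0 : Assignment n k) (Φ : Formula n k)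
           (ψ : Spec n k) (g : Gen n k) where

  Blocks : Block n k → Assignment n k → Set
  Blocks (out σ) τ = Class Q0 Δ0 Φ σ τ
  Blocks (gen σ) τ = g σ τ

  Cur : List (Block n k) → Assignment n k → Set
  Cur bs τ = τ ⊨ Φ × All (λ b → ¬ Blocks b τ) bs

  data Step (bs : List (Block n k)) : List (Block n k) → Set where
    step-out : ∀ σ → Cur bs σ → ψ (M Q0 σ) → Step bs (out σ ∷ bs)
    step-gen : ∀ σ → Cur bs σ → ¬ ψ (M Q0 σ) → Step bs (gen σ ∷ bs)

  Reach : List (Block n k) → Set
  Reach bs = Star Step [] bs

  Final : List (Block n k) → Set
  Final bs = ∀ τ → ¬ Cur bs τ

  Terminating : Set
  Terminating = Acc (λ bs' bs → Step bs bs') []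

  Sound : Set
  Sound = ∀ bs → Reach bs → ∀ σ → out σ ∈ bs → (σ ⊨ Φ) × ψ (M Q0 σ)

  CompleteUpToIso : Set
  CompleteUpToIso = ∀ bs → Reach bs → Final bs →
    ∀ ρ → ρ ⊨ Φ → ψ (M Q0 ρ) → ∃ λ σ → (out σ ∈ bs) × Iso Q0 Δ0 σ ρ

{-# OPTIONS --safe #-}
-- Every iteration blocks its chosen assignment σ for good: an output blocks [σ] ∋ σ, and a
-- generalization blocks γ̃(σ), which contains σ because σ ⊨ γ(σ) by properness. So the chosen
-- assignments are pairwise distinct, and there are only finitely many of them. When the loop
-- stops, a model ρ of Φ and ψ is excluded by some block; by properness and isomorphism invariance
-- of ψ it is not a generalization, so it is an output σ with ρ ∈ [σ].
module Submission where

open import Defs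
open import Level using (Level)
open import Data.Nat using (ℕ; zero; suc; _+_; _^_; _≤_; _<_)
open import Data.Nat.Properties
  using (+-identityʳ; +-suc; +-monoˡ-≤; ≤-trans; ≤-reflexive; <⇒≱; m≤n+m; n<1+n)
open import Data.Fin using (Fin; zero; suc; funToFin; finToFun)
open import Data.Fin.Properties using (finToFun-funToFin; injective⇒≤; 2↔Bool; all?)
import Data.Fin.Properties as Fin
open import Data.Bool using (Bool; true; false)
import Data.Bool.Properties as Bool
open import Data.Empty using (⊥; ⊥-elim)
open import Data.Product using (∃; ∃₂; _×_; _,_; proj₁; proj₂)
open import Data.List using (List; length; map; lookup)
open import Data.List.Properties using (length-map)
open import Data.List.Relation.Unary.All using (All; []; _∷_)
import Data.List.Relation.Unary.All as All
open import Data.List.Relation.Unary.All.Properties using (map⁺; ¬Any⇒All¬)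
open import Data.List.Relation.Unary.Any using (Any)
import Data.List.Relation.Unary.Any as Any
open import Data.List.Relation.Unary.Unique.Propositional using (Unique; []; _∷_)
open import Data.List.Membership.Propositional using (_∈_; find)
open import Data.List.Membership.Propositional.Properties using (∈-lookup)
open import Relation.Nullary using (¬_; Dec; yes; no; contradiction)
import Relation.Nullary.Decidable as Dec
open import Relation.Nullary.Decidable using (map′; _×-dec_; _→-dec_; ¬?)
open import Relation.Unary using (Decidable)
open import Relation.Binary using (Rel)
open import Relation.Binary.PropositionalEquality
  using (_≡_; _≢_; _≗_; refl; sym; trans; cong; subst; subst₂; module ≡-Reasoning)
open import Relation.Binary.Construct.Closure.ReflexiveTransitive using (Star; fold)
open import Induction.WellFounded using (Acc; acc)
open import Function using (_∘_; id; flip)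
open import Function.Bundles using (Inverse; Injection; _⇔_; mk⇔; mk↔ₛ′; Equivalence)
open import Function.Properties.Inverse using (↔-refl; ↔-sym; ↔⇒↣)
import Function.Properties.Equivalence as ⇔

private
  variable
    a p ℓ : Level
    A : Set a

lookup-injective : ∀ {xs : List A} → Unique xs → ∀ i j → lookup xs i ≡ lookup xs j → i ≡ j
lookup-injective (_ ∷ _)      zero    zero    _  = refl
lookup-injective (x∉xs ∷ _)   zero    (suc j) eq = contradiction eq (All.lookup x∉xs (∈-lookup j))
lookup-injective (x∉xs ∷ _)   (suc i) zero    eq = contradiction (sym eq) (All.lookup x∉xs (∈-lookup i))
lookup-injective (_ ∷ unique) (suc i) (suc j) eq = cong suc (lookup-injective unique i j eq)

Unique⇒length≤ : ∀ {N} {xs : List (Fin N)} → Unique xs → length xs ≤ N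
Unique⇒length≤ unique = injective⇒≤ (lookup-injective unique _ _)

funToFin-injective : ∀ {m l} {f g : Fin m → Fin l} → funToFin f ≡ funToFin g → f ≗ g
funToFin-injective {f = f} {g} eq i = begin
  f i                     ≡⟨ sym (finToFun-funToFin f i) ⟩
  finToFun (funToFin f) i ≡⟨ cong (λ c → finToFun c i) eq ⟩
  finToFun (funToFin g) i ≡⟨ finToFun-funToFin g i ⟩
  g i                     ∎
  where open ≡-Reasoning

any-function? : ∀ {m l} {P : (Fin m → Fin l) → Set p} →
                (∀ {f g} → f ≗ g → P f → P g) → (∀ f → Dec (P f)) → Dec (∃ P)
any-function? resp P? = map′ (λ (i , Pi) → finToFun i , Pi)
                             (λ (f , Pf) → funToFin f , resp (sym ∘ finToFun-funToFin f) Pf)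
                             (Fin.any? (P? ∘ finToFun))

_⇔-dec_ : {B : Set p} → Dec A → Dec B → Dec (A ⇔ B)
A? ⇔-dec B? = map′ (λ (f , g) → mk⇔ f g) (λ e → Equivalence.to e , Equivalence.from e)
                   ((A? →-dec B?) ×-dec (B? →-dec A?))

Star-preserves : {R : Rel A ℓ} (P : A → Set p) →
                 (∀ {x y} → R x y → P x → P y) → ∀ {x y} → Star R x y → P x → P y
Star-preserves P preserves = fold (λ x y → P x → P y) (λ r q → q ∘ preserves r) id

module _ {_⟶_ : Rel A ℓ} (Good : A → Set p) (size : A → ℕ) (bound : ℕ)
         (⟶-preserves : ∀ {x y} → x ⟶ y → Good x → Good y)
         (⟶-grows : ∀ {x y} → x ⟶ y → size x < size y)
         (Good⇒bounded : ∀ {x} → Good x → size x ≤ bound) where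

  private
    acc-within : ∀ m {x} → Good x → bound ≤ size x + m → Acc (flip _⟶_) x
    acc-within zero {x} good full = acc λ step →
      contradiction (≤-trans (Good⇒bounded (⟶-preserves step good))
                              (≤-trans full (≤-reflexive (+-identityʳ (size x)))))
                    (<⇒≱ (⟶-grows step))
    acc-within (suc m) {x} good room = acc λ step →
      acc-within m (⟶-preserves step good)
        (≤-trans room (≤-trans (≤-reflexive (+-suc (size x) m)) (+-monoˡ-≤ m (⟶-grows step))))

  bounded-growth⇒acc : ∀ {x} → Good x → Acc (flip _⟶_) x
  bounded-growth⇒acc good = acc-within bound good (m≤n+m bound _)

_≗₃_ : ∀ {n k} → Assignment n k → Assignment n k → Set
σ ≗₃ ρ = ∀ p a q → σ p a q ≡ ρ p a q

module Isomorphism {n k : ℕ} (Q0 : Fin n → Bool) (Δ0 : Assignment n k) where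

  _≃_ : Assignment n k → Assignment n k → Set
  _≃_ = Iso Q0 Δ0

  InA? : Decidable (InA Q0 Δ0)
  InA? q = (Q0 q Bool.≟ false)
    ×-dec all? (λ a → all? λ r → Δ0 q a r Bool.≟ false)
    ×-dec all? (λ p → all? λ a → Δ0 p a q Bool.≟ false)

  ≗₃⇒≃ : ∀ {σ ρ} → σ ≗₃ ρ → σ ≃ ρ
  ≗₃⇒≃ σ≗ρ = ↔-refl , (λ _ _ → refl) , λ p a q → mk⇔ (trans (sym (σ≗ρ p a q))) (trans (σ≗ρ p a q))

  ≃-sym : ∀ {σ ρ} → σ ≃ ρ → ρ ≃ σ
  ≃-sym {σ} {ρ} (f , fixes , preserves) = ↔-sym f , fixes⁻¹ , preserves⁻¹
    where
    open Inverse f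
    fixes⁻¹ : ∀ q → ¬ InA Q0 Δ0 q → from q ≡ q
    fixes⁻¹ q q∉A = trans (cong from (sym (fixes q q∉A))) (strictlyInverseʳ q)
    preserves⁻¹ : ∀ p a q → (ρ p a q ≡ true) ⇔ (σ (from p) a (from q) ≡ true)
    preserves⁻¹ p a q = ⇔.sym (subst₂ (λ x y → (σ (from p) a (from q) ≡ true) ⇔ (ρ x a y ≡ true))
                                     (strictlyInverseˡ p) (strictlyInverseˡ q) (preserves (from p) a (from q)))

  -- The bijection of σ ≃ ρ unpacked into its two component functions, which range over a finite type.
  IsoVia : (to from : Fin n → Fin n) → Assignment n k → Assignment n k → Set
  IsoVia to from σ ρ =
    (∀ x → to (from x) ≡ x) × (∀ x → from (to x) ≡ x) × (∀ q → ¬ InA Q0 Δ0 q → to q ≡ q) ×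
    (∀ p a q → (σ p a q ≡ true) ⇔ (ρ (to p) a (to q) ≡ true))

  ≃⇔IsoVia : ∀ {σ ρ} → σ ≃ ρ ⇔ (∃₂ λ to from → IsoVia to from σ ρ)
  ≃⇔IsoVia = mk⇔
    (λ (f , fixes , preserves) →
      Inverse.to f , Inverse.from f , Inverse.strictlyInverseˡ f , Inverse.strictlyInverseʳ f , fixes , preserves)
    (λ (to , from , invˡ , invʳ , fixes , preserves) → mk↔ₛ′ to from invˡ invʳ , fixes , preserves)

  IsoVia-resp-to : ∀ {to to′ from σ ρ} → to ≗ to′ → IsoVia to from σ ρ → IsoVia to′ from σ ρ
  IsoVia-resp-to {from = from} {σ} {ρ} to≗to′ (invˡ , invʳ , fixes , preserves) =
    (λ x → trans (sym (to≗to′ (from x))) (invˡ x)) ,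
    (λ x → trans (cong from (sym (to≗to′ x))) (invʳ x)) ,
    (λ q q∉A → trans (sym (to≗to′ q)) (fixes q q∉A)) ,
    (λ p a q → subst₂ (λ x y → (σ p a q ≡ true) ⇔ (ρ x a y ≡ true)) (to≗to′ p) (to≗to′ q) (preserves p a q))

  IsoVia-resp-from : ∀ {to from from′ σ ρ} → from ≗ from′ → IsoVia to from σ ρ → IsoVia to from′ σ ρ
  IsoVia-resp-from {to} from≗from′ (invˡ , invʳ , fixes , preserves) =
    (λ x → trans (cong to (sym (from≗from′ x))) (invˡ x)) ,
    (λ x → trans (sym (from≗from′ (to x))) (invʳ x)) ,
    fixes ,
    preserves

  IsoVia? : ∀ to from σ ρ → Dec (IsoVia to from σ ρ)
  IsoVia? to from σ ρ =
    all? (λ x → to (from x) Fin.≟ x) ×-dec all? (λ x → from (to x) Fin.≟ x)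
    ×-dec all? (λ q → ¬? (InA? q) →-dec (to q Fin.≟ q))
    ×-dec all? (λ p → all? λ a → all? λ q → (σ p a q Bool.≟ true) ⇔-dec (ρ (to p) a (to q) Bool.≟ true))

  _≃?_ : ∀ σ ρ → Dec (σ ≃ ρ)
  σ ≃? ρ = Dec.map (⇔.sym (≃⇔IsoVia {σ} {ρ}))
    (any-function? (λ to≗to′ (from , via) → from , IsoVia-resp-to {σ = σ} {ρ} to≗to′ via) λ to →
      any-function? (IsoVia-resp-from {σ = σ} {ρ}) λ from → IsoVia? to from σ ρ)

code : ∀ {n k} → Assignment n k → Fin (((2 ^ n) ^ k) ^ n)
code σ = funToFin λ p → funToFin λ a → funToFin λ q → Inverse.from 2↔Bool (σ p a q)

code-injective : ∀ {n k} {σ ρ : Assignment n k} → code σ ≡ code ρ → σ ≗₃ ρ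
code-injective eq p a q =
  Injection.injective (↔⇒↣ (↔-sym 2↔Bool)) (funToFin-injective (funToFin-injective (funToFin-injective eq p) a) q)

module Correctness {n k : ℕ} (Q0 : Fin n → Bool) (Δ0 : Assignment n k) (Φ : Formula n k) (ψ : Spec n k)
  (ψ-invariant : ∀ σ ρ → σ ⊨ Φ → ρ ⊨ Φ → Iso Q0 Δ0 σ ρ → ψ (M Q0 σ) ⇔ ψ (M Q0 ρ))
  (γ : Assignment n k → Formula n k) (γ-proper : Proper Q0 Φ ψ γ) where

  open Isomorphism Q0 Δ0
  open GCG Q0 Δ0 Φ ψ (EqClosure Q0 Δ0 Φ γ)

  ⊭ψ-transport : ∀ {σ ρ} → σ ⊨ Φ → ρ ⊨ Φ → σ ≃ ρ → ¬ ψ (M Q0 ρ) → ¬ ψ (M Q0 σ)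
  ⊭ψ-transport σ⊨Φ ρ⊨Φ σ≃ρ ρ⊭ψ = ρ⊭ψ ∘ Equivalence.to (ψ-invariant _ _ σ⊨Φ ρ⊨Φ σ≃ρ)

  witness : Block n k → Assignment n k
  witness (out σ) = σ
  witness (gen σ) = σ

  Justified : Block n k → Set
  Justified (out σ) = σ ⊨ Φ × ψ (M Q0 σ)
  Justified (gen σ) = σ ⊨ Φ × ¬ ψ (M Q0 σ)

  step-justified : ∀ {bs bs′} → Step bs bs′ → All Justified bs → All Justified bs′
  step-justified (step-out σ (σ⊨Φ , _) σ⊨ψ) js = (σ⊨Φ , σ⊨ψ) ∷ js
  step-justified (step-gen σ (σ⊨Φ , _) σ⊭ψ) js = (σ⊨Φ , σ⊭ψ) ∷ js

  reachable-justified : ∀ {bs} → Reach bs → All Justified bs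
  reachable-justified reach = Star-preserves (All Justified) step-justified reach []

  -- No later iteration can pick (a pointwise copy of) the witness of an earlier one.
  blocks-witness : ∀ b → Justified b → ∀ τ → τ ⊨ Φ → τ ≗₃ witness b → Blocks b τ
  blocks-witness (out σ) _ τ τ⊨Φ τ≗σ = τ⊨Φ , ≗₃⇒≃ τ≗σ
  blocks-witness (gen σ) (σ⊨Φ , σ⊭ψ) τ τ⊨Φ τ≗σ =
    τ , (τ⊨Φ , ≗₃⇒≃ τ≗σ) , proj₁ (γ-proper τ τ⊨Φ (⊭ψ-transport τ⊨Φ σ⊨Φ (≗₃⇒≃ τ≗σ) σ⊭ψ))

  gen-spares-models : ∀ σ → Justified (gen σ) → ∀ ρ → ρ ⊨ Φ → ψ (M Q0 ρ) → ¬ Blocks (gen σ) ρ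
  gen-spares-models σ (σ⊨Φ , σ⊭ψ) ρ ρ⊨Φ ρ⊨ψ (σ′ , (σ′⊨Φ , σ′≃σ) , ρ⊨γσ′) =
    proj₂ (γ-proper σ′ σ′⊨Φ (⊭ψ-transport σ′⊨Φ σ⊨Φ σ′≃σ σ⊭ψ)) ρ ρ⊨Φ ρ⊨ψ ρ⊨γσ′

  Consistent : List (Block n k) → Set
  Consistent bs = All Justified bs × Unique (map (code ∘ witness) bs)

  code-fresh : ∀ {σ bs} → σ ⊨ Φ → All Justified bs → All (λ b → ¬ Blocks b σ) bs →
               All (λ b → code σ ≢ code (witness b)) bs
  code-fresh {σ} σ⊨Φ js spared =
    All.zipWith (λ {b} (j , b-spares-σ) eq → b-spares-σ (blocks-witness b j σ σ⊨Φ (code-injective eq)))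
                (js , spared)

  step-consistent : ∀ {bs bs′} → Step bs bs′ → Consistent bs → Consistent bs′
  step-consistent s@(step-out _ (σ⊨Φ , spared) _) (js , u) =
    step-justified s js , map⁺ (code-fresh σ⊨Φ js spared) ∷ u
  step-consistent s@(step-gen _ (σ⊨Φ , spared) _) (js , u) =
    step-justified s js , map⁺ (code-fresh σ⊨Φ js spared) ∷ u

  step-grows : ∀ {bs bs′} → Step bs bs′ → length bs < length bs′
  step-grows (step-out _ _ _) = n<1+n _
  step-grows (step-gen _ _ _) = n<1+n _

  consistent-bounded : ∀ {bs} → Consistent bs → length bs ≤ ((2 ^ n) ^ k) ^ n
  consistent-bounded {bs} (_ , u) = subst (_≤ _) (length-map (code ∘ witness) bs) (Unique⇒length≤ u)

  terminating : Terminating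
  terminating = bounded-growth⇒acc Consistent length _ step-consistent step-grows consistent-bounded ([] , [])

  sound : Sound
  sound _ reach _ = All.lookup (reachable-justified reach)

  Covers : Assignment n k → Block n k → Set
  Covers ρ (out σ) = σ ≃ ρ
  Covers ρ (gen _) = ⊥

  covers? : ∀ ρ → Decidable (Covers ρ)
  covers? ρ (out σ) = σ ≃? ρ
  covers? ρ (gen _) = no id

  uncovered-spares : ∀ {ρ} → ρ ⊨ Φ → ψ (M Q0 ρ) → ∀ b → Justified b → ¬ Covers ρ b → ¬ Blocks b ρ
  uncovered-spares _   _   (out σ) _ uncovered (_ , ρ≃σ) = uncovered (≃-sym ρ≃σ)
  uncovered-spares ρ⊨Φ ρ⊨ψ (gen σ) j _ = gen-spares-models σ j _ ρ⊨Φ ρ⊨ψ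

  covering-output : ∀ {ρ bs} → Any (Covers ρ) bs → ∃ λ σ → out σ ∈ bs × σ ≃ ρ
  covering-output c with find c
  ... | out σ , σ∈bs , σ≃ρ = σ , σ∈bs , σ≃ρ

  -- Deciding ≃ turns the refutation of Φ_cur at ρ into an explicit output isomorphic to ρ.
  complete : CompleteUpToIso
  complete bs reach final ρ ρ⊨Φ ρ⊨ψ with Any.any? (covers? ρ) bs
  ... | yes covered = covering-output covered
  ... | no uncovered = ⊥-elim (final ρ (ρ⊨Φ , All.zipWith (λ {b} (j , ¬c) → uncovered-spares ρ⊨Φ ρ⊨ψ b j ¬c)
                                                           (reachable-justified reach , ¬Any⇒All¬ bs uncovered)))

theorem4 : ∀ {n k : ℕ} (Q0 : Fin n → Bool) (Δ0 : Assignment n k) (Φ : Formula n k) (ψ : Spec n k)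
               → ImpliesΔ0 Δ0 Φ
               → (∀ σ ρ → σ ⊨ Φ → ρ ⊨ Φ → Iso Q0 Δ0 σ ρ → ψ (M Q0 σ) ⇔ ψ (M Q0 ρ))
               → (γ : Assignment n k → Formula n k) → Proper Q0 Φ ψ γ
               → let open GCG Q0 Δ0 Φ ψ (EqClosure Q0 Δ0 Φ γ)
                 in Terminating × Sound × CompleteUpToIso
theorem4 Q0 Δ0 Φ ψ _ ψ-invariant γ γ-proper = terminating , sound , complete
  where open Correctness Q0 Δ0 Φ ψ ψ-invariant γ γ-proper
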